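{- Let $G$ be a graph having a dominating vertex (a vertex adjacent to all other vertices), and let $m,r$ be positive integers with $|V(G)|\ge r-m+1\ge\lfloor r/m\rfloor\ge 1$. Then $\sigma(G,m,r)=\lfloor r/m\rfloor$.
   Context: The game $\mathrm{RS}(G,m,r,s)$ is played on a finite graph $G$ by $r$ revolutionaries and $s$ spies. First each revolutionary occupies a vertex, then each spy occupies a vertex (several players may share a vertex). In each subsequent round, each revolutionary may move to an adjacent vertex or stay put, and then each spy may move to an adjacent vertex or stay put; all positions are known to all players. The revolutionaries win if at the end of some round (the initial placement counts as a round) some vertex holds at least $m$ revolutionaries and no spy; the spies win if this never happens. $\sigma(G,m,r)$ denotes the minimum $s$ such that the spies have a winning strategy in $\mathrm{RS}(G,m,r,s)$. -}

module Defs where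

open import Data.Nat using (ℕ; _≤_)
open import Data.Fin using (Fin; _≟_)
open import Data.List using (List; []; _∷_; length; filter; allFin)
open import Data.Product using (Σ; _×_; _,_)
open import Data.Sum using (_⊎_)
open import Relation.Nullary using (¬_)
open import Relation.Binary.PropositionalEquality using (_≡_; _≢_)
open import Level using (0ℓ; suc)

record Graph : Set₁ where
  field
    n     : ℕ
    Adj   : Fin n → Fin n → Set
    sym   : ∀ {u v} → Adj u v → Adj v u
    irrefl : ∀ {u} → ¬ Adj u u

open Graph public

∣V∣ : Graph → ℕ
∣V∣ G = n G

HasDominatingVertex : Graph → Set
HasDominatingVertex G = Σ (Fin (n G)) λ v → ∀ u → u ≢ v → Adj G v u

-- positions of k players (revolutionaries or spies)
Conf : Graph → ℕ → Set
Conf G k = Fin k → Fin (n G)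

Step : (G : Graph) {k : ℕ} → Conf G k → Conf G k → Set
Step G X Y = ∀ i → Y i ≡ X i ⊎ Adj G (X i) (Y i)

countAt : (G : Graph) {k : ℕ} → Conf G k → Fin (n G) → ℕ
countAt G {k} X v = length (filter (λ i → X i ≟ v) (allFin k))

-- the revolutionaries' winning condition at the end of a round:
-- some vertex holds at least m revolutionaries and no spy
RevWin : (G : Graph) (m : ℕ) {r s : ℕ} → Conf G r → Conf G s → Set
RevWin G m R P = Σ (Fin (n G)) λ v → (m ≤ countAt G R v) × (∀ j → P j ≢ v)

-- position at the end of a round: (revolutionaries, spies)
Pos : Graph → ℕ → ℕ → Set
Pos G r s = Conf G r × Conf G s

-- a (history-dependent) spy strategy: given the list of positions at the end
-- of all previous rounds (most recent first; empty before the initial placement)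
-- and the revolutionaries' current placement, it gives the spies' placement.
SpyStrategy : Graph → ℕ → ℕ → Set
SpyStrategy G r s = List (Pos G r s) → Conf G r → Conf G s

-- histories (most recent first) that can arise when spies follow σ and the
-- revolutionaries play legally but otherwise arbitrarily
data Consistent (G : Graph) {r s : ℕ} (σ : SpyStrategy G r s) : List (Pos G r s) → Set where
  start : ∀ R → Consistent G σ ((R , σ [] R) ∷ [])
  next  : ∀ {h R P} → Consistent G σ ((R , P) ∷ h) →
          ∀ R' → Step G R R' →
          Consistent G σ ((R' , σ ((R , P) ∷ h) R') ∷ (R , P) ∷ h)

Winning : (G : Graph) (m r s : ℕ) → SpyStrategy G r s → Set
Winning G m r s σ =
  (∀ {h R P} → Consistent G σ ((R , P) ∷ h) →
     ∀ R' → Step G R R' → Step G P (σ ((R , P) ∷ h) R'))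
  × (∀ {h R P} → Consistent G σ ((R , P) ∷ h) → ¬ RevWin G m R P)

SpiesWin : Graph → ℕ → ℕ → ℕ → Set
SpiesWin G m r s = Σ (SpyStrategy G r s) (Winning G m r s)

IsSigma : Graph → ℕ → ℕ → ℕ → Set
IsSigma G m r k = SpiesWin G m r k × (∀ s → s Data.Nat.< k → ¬ SpiesWin G m r s)

module Submission where

-- With K = ⌊r/m⌋ ≤ |V(G)| the revolutionaries can occupy K
-- distinct vertices with m of them each; fewer than K spies leave one of these
-- vertices free already after the initial placement (pigeonhole).
--
-- K spies keep the invariant that every vertex holding ≥ m
-- revolutionaries (a heavy vertex) carries a spy, and every spy off v sits on
-- a heavy vertex of its own.  When the revolutionaries move, a spy may go to v,
-- leave v for any vertex, or follow a revolutionary from its vertex.  By a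
-- counting argument these options satisfy Hall's condition for the new heavy
-- vertices, so Hall's theorem provides a matching that restores the invariant.

open import Defs hiding (sym)
open import Data.Nat using (ℕ; _≤_; _+_; _∸_; _/_; NonZero; _*_)
open import Data.Nat.Properties using (≤-trans)
open import Data.Nat.DivMod using (m/n*n≤m)
open import Data.Fin using (Fin; fromℕ<)
open import Data.Product using (_,_)
open import Relation.Binary.PropositionalEquality using (_≢_)

module FiniteSets where

  open import Data.Nat using (ℕ; zero; suc; _+_; _*_; _≤_; z≤n; s≤s)
  open import Data.Nat.Properties
    using (≤-refl; ≤-trans; ≤-reflexive; m≤n⇒m≤1+n; +-mono-≤; +-comm; +-identityʳ;
           *-zeroʳ; *-identityʳ; *-identityˡ; *-distribˡ-+; 1+n≰n; module ≤-Reasoning; +-commutativeSemigroup)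
  open import Algebra.Properties.CommutativeSemigroup +-commutativeSemigroup using (interchange)
  open import Data.Bool using (Bool; true; false; _∧_; _∨_; not)
  open import Data.Fin using (Fin; zero; suc; _≟_)
  open import Data.Fin.Properties using (suc-injective; 0≢1+n)
  open import Data.Product using (Σ; _×_; _,_; proj₂)
  open import Data.Sum using (_⊎_; inj₁; inj₂)
  open import Data.Empty using (⊥-elim)
  open import Relation.Nullary using (¬_; Dec; yes; no; does)
  open import Relation.Nullary.Decidable using (dec-true; dec-false)
  open import Relation.Binary.PropositionalEquality

  ∨-introˡ : ∀ {a b} → a ≡ true → (a ∨ b) ≡ true
  ∨-introˡ refl = refl

  ∨-introʳ : ∀ a {b} → b ≡ true → (a ∨ b) ≡ true
  ∨-introʳ true  _ = refl
  ∨-introʳ false p = p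

  ∨-elim : ∀ a {b} → (a ∨ b) ≡ true → a ≡ true ⊎ b ≡ true
  ∨-elim true  _ = inj₁ refl
  ∨-elim false p = inj₂ p

  ∧-intro : ∀ {a b} → a ≡ true → b ≡ true → (a ∧ b) ≡ true
  ∧-intro refl refl = refl

  ∧-elim : ∀ a {b} → (a ∧ b) ≡ true → a ≡ true × b ≡ true
  ∧-elim true p = refl , p

  not-true : ∀ {a} → not a ≡ true → ¬ a ≡ true
  not-true {true} () _

  does⇒ : ∀ {A : Set} (a? : Dec A) → does a? ≡ true → A
  does⇒ (yes a) _ = a

  true≢false : ¬ true ≡ false
  true≢false ()

  ≡true-irrelevant : {b : Bool} (p q : b ≡ true) → p ≡ q
  ≡true-irrelevant refl refl = refl

  FinSet : ℕ → Set
  FinSet a = Fin a → Bool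

  FinRel : ℕ → ℕ → Set
  FinRel a b = Fin a → Fin b → Bool

  infix  4 _∈_ _∉_ _⊆_
  infixr 7 _∩_
  infixr 6 _∪_
  infixl 8 _─_

  _∈_ : ∀ {a} → Fin a → FinSet a → Set
  x ∈ s = s x ≡ true

  _∉_ : ∀ {a} → Fin a → FinSet a → Set
  x ∉ s = ¬ x ∈ s

  _⊆_ : ∀ {a} → FinSet a → FinSet a → Set
  s ⊆ t = ∀ x → x ∈ s → x ∈ t

  _∪_ _∩_ : ∀ {a} → FinSet a → FinSet a → FinSet a
  (s ∪ t) x = s x ∨ t x
  (s ∩ t) x = s x ∧ t x

  ∁ : ∀ {a} → FinSet a → FinSet a
  ∁ s x = not (s x)

  ⁅_⁆ : ∀ {a} → Fin a → FinSet a
  ⁅ i ⁆ x = does (x ≟ i)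

  _─_ : ∀ {a} → FinSet a → Fin a → FinSet a
  (s ─ i) x = s x ∧ not (⁅ i ⁆ x)

  any : ∀ {a} → FinSet a → Bool
  any {zero}  s = false
  any {suc a} s = s zero ∨ any (λ x → s (suc x))

  image : ∀ {a b} → FinRel a b → FinSet a → FinSet b
  image F s y = any (λ x → s x ∧ F x y)

  bit : Bool → ℕ
  bit true  = 1
  bit false = 0

  ∣_∣ : ∀ {a} → FinSet a → ℕ
  ∣_∣ {zero}  s = 0
  ∣_∣ {suc a} s = bit (s zero) + ∣ (λ x → s (suc x)) ∣

  x∈⁅x⁆ : ∀ {a} (i : Fin a) → i ∈ ⁅ i ⁆
  x∈⁅x⁆ i = dec-true (i ≟ i) refl

  x∈⁅y⁆⇒x≡y : ∀ {a} (i x : Fin a) → x ∈ ⁅ i ⁆ → x ≡ i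
  x∈⁅y⁆⇒x≡y i x = does⇒ (x ≟ i)

  x≢y⇒x∉⁅y⁆ : ∀ {a} (i x : Fin a) → x ≢ i → ⁅ i ⁆ x ≡ false
  x≢y⇒x∉⁅y⁆ i x = dec-false (x ≟ i)

  ⁅⁆⊆ : ∀ {a} (s : FinSet a) i → i ∈ s → ⁅ i ⁆ ⊆ s
  ⁅⁆⊆ s i i∈s x p = subst (_∈ s) (sym (x∈⁅y⁆⇒x≡y i x p)) i∈s

  ─-intro : ∀ {a} (s : FinSet a) i x → x ∈ s → x ≢ i → x ∈ s ─ i
  ─-intro s i x x∈s x≢i rewrite x∈s | x≢y⇒x∉⁅y⁆ i x x≢i = refl

  ─-elim : ∀ {a} (s : FinSet a) i x → x ∈ s ─ i → x ∈ s × x ≢ i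
  ─-elim s i x p =
    let (x∈s , x∉i) = ∧-elim (s x) p
    in x∈s , λ x≡i → not-true x∉i (subst (_∈ ⁅ i ⁆) (sym x≡i) (x∈⁅x⁆ i))

  any-intro : ∀ {a} (s : FinSet a) x → x ∈ s → any s ≡ true
  any-intro s zero    p = ∨-introˡ p
  any-intro s (suc x) p = ∨-introʳ (s zero) (any-intro (λ y → s (suc y)) x p)

  any-elim : ∀ {a} (s : FinSet a) → any s ≡ true → Σ (Fin a) (_∈ s)
  any-elim {suc a} s p with ∨-elim (s zero) p
  ... | inj₁ q = zero , q
  ... | inj₂ q with any-elim (λ y → s (suc y)) q
  ... | x , r = suc x , r

  any-cong : ∀ {a} {s t : FinSet a} → (∀ x → s x ≡ t x) → any s ≡ any t
  any-cong {zero}  e = refl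
  any-cong {suc a} e = cong₂ _∨_ (e zero) (any-cong (λ x → e (suc x)))

  image-intro : ∀ {a b} (F : FinRel a b) (s : FinSet a) x y → x ∈ s → F x y ≡ true → y ∈ image F s
  image-intro F s x y x∈s Fxy = any-intro _ x (∧-intro x∈s Fxy)

  image-elim : ∀ {a b} (F : FinRel a b) (s : FinSet a) y → y ∈ image F s →
    Σ (Fin a) λ x → x ∈ s × F x y ≡ true
  image-elim F s y p = let (x , q) = any-elim _ p in x , ∧-elim (s x) q

  ∣∣-cong : ∀ {a} {s t : FinSet a} → (∀ x → s x ≡ t x) → ∣ s ∣ ≡ ∣ t ∣
  ∣∣-cong {zero}  e = refl
  ∣∣-cong {suc a} e = cong₂ _+_ (cong bit (e zero)) (∣∣-cong (λ x → e (suc x)))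

  ∣∣-mono : ∀ {a} {s t : FinSet a} → s ⊆ t → ∣ s ∣ ≤ ∣ t ∣
  ∣∣-mono {zero}  h = z≤n
  ∣∣-mono {suc a} h = +-mono-≤ (bit-mono (h zero)) (∣∣-mono (λ x → h (suc x)))
    where
    bit-mono : ∀ {b c} → (b ≡ true → c ≡ true) → bit b ≤ bit c
    bit-mono {false} _ = z≤n
    bit-mono {true}  h rewrite h refl = ≤-refl

  ∣∣≤size : ∀ {a} (s : FinSet a) → ∣ s ∣ ≤ a
  ∣∣≤size {zero}  s = z≤n
  ∣∣≤size {suc a} s with s zero
  ... | true  = s≤s (∣∣≤size (λ x → s (suc x)))
  ... | false = m≤n⇒m≤1+n (∣∣≤size (λ x → s (suc x)))

  ∣full∣ : ∀ {a} (s : FinSet a) → (∀ x → x ∈ s) → ∣ s ∣ ≡ a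
  ∣full∣ {zero}  s h = refl
  ∣full∣ {suc a} s h rewrite h zero = cong suc (∣full∣ (λ x → s (suc x)) (λ x → h (suc x)))

  ∣empty∣ : ∀ {a} (s : FinSet a) → (∀ x → x ∉ s) → ∣ s ∣ ≡ 0
  ∣empty∣ {zero}  s h = refl
  ∣empty∣ {suc a} s h with s zero in eq
  ... | true  = ⊥-elim (h zero eq)
  ... | false = ∣empty∣ (λ x → s (suc x)) (λ x → h (suc x))

  nonempty : ∀ {a} (s : FinSet a) → 1 ≤ ∣ s ∣ → Σ (Fin a) (_∈ s)
  nonempty {suc a} s p with s zero in eq
  ... | true  = zero , eq
  ... | false with nonempty (λ x → s (suc x)) p
  ... | x , q = suc x , q

  inclusion-exclusion : ∀ {a} (s t : FinSet a) → ∣ s ∪ t ∣ + ∣ s ∩ t ∣ ≡ ∣ s ∣ + ∣ t ∣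
  inclusion-exclusion {zero}  s t = refl
  inclusion-exclusion {suc a} s t = begin
    (bit (s₀ ∨ t₀) + ∣ s' ∪ t' ∣) + (bit (s₀ ∧ t₀) + ∣ s' ∩ t' ∣)
      ≡⟨ interchange (bit (s₀ ∨ t₀)) _ _ _ ⟩
    (bit (s₀ ∨ t₀) + bit (s₀ ∧ t₀)) + (∣ s' ∪ t' ∣ + ∣ s' ∩ t' ∣)
      ≡⟨ cong₂ _+_ (bits s₀ t₀) (inclusion-exclusion s' t') ⟩
    (bit s₀ + bit t₀) + (∣ s' ∣ + ∣ t' ∣)
      ≡⟨ interchange (bit s₀) _ _ _ ⟩
    (bit s₀ + ∣ s' ∣) + (bit t₀ + ∣ t' ∣) ∎
    where
    open ≡-Reasoning
    s₀ t₀ : Bool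
    s₀ = s zero ; t₀ = t zero
    s' t' : FinSet a
    s' x = s (suc x) ; t' x = t (suc x)
    bits : ∀ b c → bit (b ∨ c) + bit (b ∧ c) ≡ bit b + bit c
    bits true  true  = refl
    bits true  false = refl
    bits false true  = refl
    bits false false = refl

  ∣∪∣-disjoint : ∀ {a} (s t : FinSet a) → (∀ x → x ∈ s → x ∉ t) → ∣ s ∪ t ∣ ≡ ∣ s ∣ + ∣ t ∣
  ∣∪∣-disjoint s t disj = begin
    ∣ s ∪ t ∣                 ≡⟨ sym (+-identityʳ _) ⟩
    ∣ s ∪ t ∣ + 0             ≡⟨ cong (∣ s ∪ t ∣ +_) (sym (∣empty∣ (s ∩ t) no-common)) ⟩
    ∣ s ∪ t ∣ + ∣ s ∩ t ∣     ≡⟨ inclusion-exclusion s t ⟩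
    ∣ s ∣ + ∣ t ∣ ∎
    where
    open ≡-Reasoning
    no-common : ∀ x → x ∉ s ∩ t
    no-common x p = let (x∈s , x∈t) = ∧-elim (s x) p in disj x x∈s x∈t

  ∣∣+∣∁∣ : ∀ {a} (s : FinSet a) → ∣ s ∣ + ∣ ∁ s ∣ ≡ a
  ∣∣+∣∁∣ {a} s = begin
    ∣ s ∣ + ∣ ∁ s ∣   ≡⟨ sym (∣∪∣-disjoint s (∁ s) λ x x∈s x∈∁s → not-true x∈∁s x∈s) ⟩
    ∣ s ∪ ∁ s ∣       ≡⟨ ∣full∣ (s ∪ ∁ s) (λ x → excluded-middle (s x)) ⟩
    a ∎
    where
    open ≡-Reasoning
    excluded-middle : ∀ b → (b ∨ not b) ≡ true
    excluded-middle true  = refl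
    excluded-middle false = refl

  ∣⁅⁆∣≡1 : ∀ {a} (i : Fin a) → ∣ ⁅ i ⁆ ∣ ≡ 1
  ∣⁅⁆∣≡1 {suc a} zero    = cong suc (∣empty∣ {a} (λ _ → false) (λ _ ()))
  ∣⁅⁆∣≡1 {suc a} (suc i) = ∣⁅⁆∣≡1 i

  ∣─∣ : ∀ {a} (s : FinSet a) i → i ∈ s → ∣ s ∣ ≡ suc ∣ s ─ i ∣
  ∣─∣ s i i∈s = begin
    ∣ s ∣                   ≡⟨ ∣∣-cong split ⟩
    ∣ ⁅ i ⁆ ∪ s ─ i ∣       ≡⟨ ∣∪∣-disjoint ⁅ i ⁆ (s ─ i) (λ x x∈i x∈s─i → not-true (proj₂ (∧-elim (s x) x∈s─i)) x∈i) ⟩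
    ∣ ⁅ i ⁆ ∣ + ∣ s ─ i ∣   ≡⟨ cong (_+ ∣ s ─ i ∣) (∣⁅⁆∣≡1 i) ⟩
    suc ∣ s ─ i ∣ ∎
    where
    open ≡-Reasoning
    split : ∀ x → s x ≡ (⁅ i ⁆ ∪ s ─ i) x
    split x with x ≟ i
    ... | yes refl rewrite i∈s = refl
    ... | no  _ with s x
    ... | true  = refl
    ... | false = refl

  ∣∪⁅⁆∣ : ∀ {a} (s : FinSet a) i → i ∉ s → ∣ s ∪ ⁅ i ⁆ ∣ ≡ suc ∣ s ∣
  ∣∪⁅⁆∣ s i i∉s = begin
    ∣ s ∪ ⁅ i ⁆ ∣       ≡⟨ ∣∪∣-disjoint s ⁅ i ⁆ (λ x x∈s x∈i → i∉s (subst (_∈ s) (x∈⁅y⁆⇒x≡y i x x∈i) x∈s)) ⟩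
    ∣ s ∣ + ∣ ⁅ i ⁆ ∣   ≡⟨ cong (∣ s ∣ +_) (∣⁅⁆∣≡1 i) ⟩
    ∣ s ∣ + 1           ≡⟨ +-comm ∣ s ∣ 1 ⟩
    suc ∣ s ∣ ∎
    where open ≡-Reasoning

  ∣∣≤1⇒unique : ∀ {a} (s : FinSet a) x y → ∣ s ∣ ≤ 1 → x ∈ s → y ∈ s → y ≡ x
  ∣∣≤1⇒unique s x y ∣s∣≤1 x∈s y∈s with y ≟ x
  ... | yes y≡x = y≡x
  ... | no  y≢x = ⊥-elim (1+n≰n (begin
    2                 ≤⟨ s≤s (subst (_≤ ∣ s ─ x ∣) (∣⁅⁆∣≡1 y) (∣∣-mono (⁅⁆⊆ (s ─ x) y (─-intro s x y y∈s y≢x)))) ⟩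
    suc ∣ s ─ x ∣     ≡⟨ sym (∣─∣ s x x∈s) ⟩
    ∣ s ∣             ≤⟨ ∣s∣≤1 ⟩
    1 ∎))
    where open ≤-Reasoning

  disjoint-blocks : ∀ {a b} m (s : FinSet a) (F : FinRel a b) →
    (∀ x → x ∈ s → m ≤ ∣ F x ∣) →
    (∀ x x' y → x ∈ s → x' ∈ s → F x y ≡ true → F x' y ≡ true → x ≡ x') →
    m * ∣ s ∣ ≤ ∣ image F s ∣
  disjoint-blocks {zero}  m s F big disj = subst (_≤ ∣ image F s ∣) (sym (*-zeroʳ m)) z≤n
  disjoint-blocks {suc a} {b} m s F big disj = begin
    m * (bit (s zero) + ∣ s' ∣)       ≡⟨ *-distribˡ-+ m (bit (s zero)) ∣ s' ∣ ⟩
    m * bit (s zero) + m * ∣ s' ∣     ≤⟨ +-mono-≤ first-block rest ⟩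
    ∣ first ∣ + ∣ image F' s' ∣       ≡⟨ sym (∣∪∣-disjoint first (image F' s') separate) ⟩
    ∣ first ∪ image F' s' ∣ ∎
    where
    open ≤-Reasoning
    s' : FinSet a
    s' x = s (suc x)
    F' : FinRel a b
    F' x = F (suc x)
    first : FinSet b
    first y = s zero ∧ F zero y
    first-block : m * bit (s zero) ≤ ∣ first ∣
    first-block with s zero in eq
    ... | true  = subst (_≤ ∣ F zero ∣) (sym (*-identityʳ m)) (big zero eq)
    ... | false = ≤-trans (≤-reflexive (*-zeroʳ m)) z≤n
    rest : m * ∣ s' ∣ ≤ ∣ image F' s' ∣
    rest = disjoint-blocks m s' F' (λ x → big (suc x))
             (λ x x' y p p' q q' → suc-injective (disj (suc x) (suc x') y p p' q q'))
    separate : ∀ y → y ∈ first → y ∉ image F' s'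
    separate y p q =
      let (s0 , F0y) = ∧-elim (s zero) p
          (x , x∈s' , Fxy) = image-elim F' s' y q
      in 0≢1+n (disj zero (suc x) y s0 x∈s' F0y Fxy)

  injection⇒≤∣∣ : ∀ {a m} (t : FinSet a) (g : Fin m → Fin a) →
    (∀ d d' → g d ≡ g d' → d ≡ d') → (∀ d → g d ∈ t) → m ≤ ∣ t ∣
  injection⇒≤∣∣ {a} {m} t g injective g∈t = begin
    m                                 ≡⟨ sym (*-identityˡ m) ⟩
    1 * m                             ≡⟨ cong (1 *_) (sym (∣full∣ everything (λ _ → refl))) ⟩
    1 * ∣ everything ∣                ≤⟨ disjoint-blocks 1 everything singletons one distinct ⟩
    ∣ image singletons everything ∣   ≤⟨ ∣∣-mono inside ⟩
    ∣ t ∣ ∎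
    where
    open ≤-Reasoning
    everything : FinSet m
    everything _ = true
    singletons : FinRel m a
    singletons d = ⁅ g d ⁆
    one : ∀ d → d ∈ everything → 1 ≤ ∣ ⁅ g d ⁆ ∣
    one d _ = ≤-reflexive (sym (∣⁅⁆∣≡1 (g d)))
    distinct : ∀ d d' y → d ∈ everything → d' ∈ everything → y ∈ ⁅ g d ⁆ → y ∈ ⁅ g d' ⁆ → d ≡ d'
    distinct d d' y _ _ p p' = injective d d' (trans (sym (x∈⁅y⁆⇒x≡y (g d) y p)) (x∈⁅y⁆⇒x≡y (g d') y p'))
    inside : image singletons everything ⊆ t
    inside y p = let (d , _ , y∈gd) = image-elim singletons everything y p
                 in subst (_∈ t) (sym (x∈⁅y⁆⇒x≡y (g d) y y∈gd)) (g∈t d)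

-- Hall's marriage theorem for a bipartite graph E between a set L ⊆ Fin a
-- of left vertices and Fin b, by Rado's edge-deletion argument: while some
-- left vertex has two edges, one of them can be deleted without breaking
-- Hall's condition; once every left vertex has exactly one edge, those
-- edges form the matching.
module HallsTheorem where

  open import Data.Nat using (ℕ; zero; suc; _+_; _≤_; _<_; z≤n; s≤s; _≤?_; _<?_)
  open import Data.Nat.Properties
    using (≤-refl; ≤-trans; +-mono-≤; +-mono-<-≤; +-mono-≤-<; ≤-pred; <⇒≱; ≮⇒≥; 1+n≰n;
           module ≤-Reasoning)
  open import Data.Nat.Induction using (<-wellFounded)
  open import Induction.WellFounded using (Acc; acc)
  open import Data.Bool using (Bool; true; false; _∧_; _∨_; not)
  open import Data.Bool.Properties using () renaming (_≟_ to _≟ᵇ_)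
  open import Data.Fin using (Fin; zero; suc; _≟_)
  open import Data.Fin.Properties using (any?; all?)
  open import Data.Fin.Subset.Properties using (anySubset?)
  open import Data.Vec using (lookup; tabulate)
  open import Data.Vec.Properties using (lookup∘tabulate)
  open import Data.Product using (Σ; _×_; _,_; proj₁; proj₂)
  open import Data.Sum using (_⊎_; inj₁; inj₂)
  open import Data.Empty using (⊥-elim)
  open import Relation.Nullary using (¬_; Dec; yes; no)
  open import Relation.Nullary.Decidable using (_×-dec_)
  open import Relation.Binary.PropositionalEquality
  open FiniteSets

  HallCondition : ∀ {a b} → FinSet a → FinRel a b → Set
  HallCondition L E = ∀ s → s ⊆ L → ∣ s ∣ ≤ ∣ image E s ∣

  Deficient : ∀ {a b} → FinSet a → FinRel a b → FinSet a → Set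
  Deficient L E s = s ⊆ L × ∣ image E s ∣ < ∣ s ∣

  record Matching {a b} (L : FinSet a) (E : FinRel a b) : Set where
    field
      partner   : ∀ i → i ∈ L → Fin b
      adjacent  : ∀ i p → E i (partner i p) ≡ true
      injective : ∀ i i' p p' → partner i p ≡ partner i' p' → i ≡ i'

  matching-⊆ : ∀ {a b} {L : FinSet a} {E E' : FinRel a b} →
    (∀ x → E x ⊆ E' x) → Matching L E → Matching L E'
  matching-⊆ E⊆E' M = record
    { partner   = partner
    ; adjacent  = λ i p → E⊆E' i (partner i p) (adjacent i p)
    ; injective = injective }
    where open Matching M

  _⊆?_ : ∀ {a} (s t : FinSet a) → Dec (s ⊆ t)
  s ⊆? t = all? λ x → implies? (s x) (t x)
    where
    implies? : (u v : Bool) → Dec (u ≡ true → v ≡ true)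
    implies? false _     = yes λ ()
    implies? true  true  = yes λ _ → refl
    implies? true  false = no λ f → true≢false (sym (f refl))

  deficient? : ∀ {a b} (L : FinSet a) (E : FinRel a b) s → Dec (Deficient L E s)
  deficient? L E s = (s ⊆? L) ×-dec (∣ image E s ∣ <? ∣ s ∣)

  deficient-cong : ∀ {a b} {L : FinSet a} {E : FinRel a b} {s t} →
    (∀ x → s x ≡ t x) → Deficient L E s → Deficient L E t
  deficient-cong {E = E} s≗t (s⊆L , small) =
      (λ x p → s⊆L x (trans (s≗t x) p))
    , subst₂ _<_ (∣∣-cong λ y → any-cong λ x → cong (_∧ E x y) (s≗t x)) (∣∣-cong s≗t) small

  hall? : ∀ {a b} (L : FinSet a) (E : FinRel a b) → HallCondition L E ⊎ Σ (FinSet a) (Deficient L E)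
  hall? L E with anySubset? (λ S → deficient? L E (lookup S))
  ... | yes (S , d) = inj₂ (lookup S , d)
  ... | no  none    = inj₁ λ s s⊆L → ≮⇒≥ λ small →
          none (tabulate s , deficient-cong {E = E} (λ x → sym (lookup∘tabulate s x)) (s⊆L , small))

  delete : ∀ {a b} → FinRel a b → Fin a → Fin b → FinRel a b
  delete E i j x y = E x y ∧ not (⁅ i ⁆ x ∧ ⁅ j ⁆ y)

  delete-⊆ : ∀ {a b} (E : FinRel a b) i j x → delete E i j x ⊆ E x
  delete-⊆ E i j x y p = proj₁ (∧-elim (E x y) p)

  delete-keeps-row : ∀ {a b} (E : FinRel a b) i j x y → x ≢ i → E x y ≡ true → delete E i j x y ≡ true
  delete-keeps-row E i j x y x≢i p rewrite p | x≢y⇒x∉⁅y⁆ i x x≢i = refl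

  delete-keeps-column : ∀ {a b} (E : FinRel a b) i j x y → y ≢ j → E x y ≡ true → delete E i j x y ≡ true
  delete-keeps-column E i j x y y≢j p rewrite p | x≢y⇒x∉⁅y⁆ j y y≢j with ⁅ i ⁆ x
  ... | true  = refl
  ... | false = refl

  delete-row : ∀ {a b} (E : FinRel a b) i j y → delete E i j i y ≡ (E i ─ j) y
  delete-row E i j y rewrite x∈⁅x⁆ i = refl

  sumF : ∀ {a} → (Fin a → ℕ) → ℕ
  sumF {zero}  g = 0
  sumF {suc a} g = g zero + sumF (λ x → g (suc x))

  sumF-mono : ∀ {a} {g h : Fin a → ℕ} → (∀ x → g x ≤ h x) → sumF g ≤ sumF h
  sumF-mono {zero}  _   = z≤n
  sumF-mono {suc a} g≤h = +-mono-≤ (g≤h zero) (sumF-mono (λ x → g≤h (suc x)))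

  sumF-mono-< : ∀ {a} (g h : Fin a → ℕ) → (∀ x → g x ≤ h x) → ∀ i → g i < h i → sumF g < sumF h
  sumF-mono-< g h g≤h zero    lt = +-mono-<-≤ lt (sumF-mono (λ x → g≤h (suc x)))
  sumF-mono-< g h g≤h (suc i) lt = +-mono-≤-< (g≤h zero) (sumF-mono-< _ _ (λ x → g≤h (suc x)) i lt)

  -- The number of edges, the measure that decreases under deletion.
  edges : ∀ {a b} → FinRel a b → ℕ
  edges E = sumF λ x → ∣ E x ∣

  edges-delete : ∀ {a b} (E : FinRel a b) i j → E i j ≡ true → edges (delete E i j) < edges E
  edges-delete E i j Eij = sumF-mono-< _ _ (λ x → ∣∣-mono (delete-⊆ E i j x)) i (begin-strict
    ∣ delete E i j i ∣    ≡⟨ ∣∣-cong (delete-row E i j) ⟩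
    ∣ E i ─ j ∣           <⟨ ≤-refl ⟩
    suc ∣ E i ─ j ∣       ≡⟨ sym (∣─∣ (E i) j Eij) ⟩
    ∣ E i ∣ ∎)
    where open ≤-Reasoning

  avoiding-i : ∀ {a b} (L : FinSet a) (E : FinRel a b) → HallCondition L E →
    ∀ i j s → s ⊆ L → s i ≡ false → ∣ s ∣ ≤ ∣ image (delete E i j) s ∣
  avoiding-i L E hall i j s s⊆L i∉s = ≤-trans (hall s s⊆L) (∣∣-mono kept)
    where
    kept : image E s ⊆ image (delete E i j) s
    kept y p =
      let (x , x∈s , Exy) = image-elim E s y p
          x≢i : x ≢ i
          x≢i x≡i = true≢false (trans (sym x∈s) (trans (cong s x≡i) i∉s))
      in image-intro (delete E i j) s x y x∈s (delete-keeps-row E i j x y x≢i Exy)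

  -- Rado's lemma: if i ∈ L has two distinct edges (i , j₁) and (i , j₂), then
  -- Hall's condition survives the deletion of one of them.
  module Rado {a b} (L : FinSet a) (E : FinRel a b) (hall : HallCondition L E)
              (i : Fin a) (i∈L : i ∈ L) where

    -- The neighbours of s that certainly survive the deletion of (i , j).
    survivors : FinSet a → Fin b → FinSet b
    survivors s j = image E (s ─ i) ∪ (E i ─ j)

    survivors⊆ : ∀ s j → i ∈ s → survivors s j ⊆ image (delete E i j) s
    survivors⊆ s j i∈s y p with ∨-elim (image E (s ─ i) y) p
    ... | inj₁ q = let (x , x∈s─i , Exy) = image-elim E (s ─ i) y q
                       (x∈s , x≢i) = ─-elim s i x x∈s─i
                   in image-intro (delete E i j) s x y x∈s (delete-keeps-row E i j x y x≢i Exy)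
    ... | inj₂ q = let (Eiy , y≢j) = ─-elim (E i) j y q
                   in image-intro (delete E i j) s i y i∈s (delete-keeps-column E i j i y y≢j Eiy)

    few-survivors : ∀ s j → Deficient L (delete E i j) s → ∣ survivors s j ∣ ≤ ∣ s ─ i ∣
    few-survivors s j (s⊆L , small) with s i in i∈s
    ... | false = ⊥-elim (<⇒≱ small (avoiding-i L E hall i j s s⊆L i∈s))
    ... | true  = ≤-pred (begin-strict
      ∣ survivors s j ∣                 ≤⟨ ∣∣-mono (survivors⊆ s j i∈s) ⟩
      ∣ image (delete E i j) s ∣        <⟨ small ⟩
      ∣ s ∣                             ≡⟨ ∣─∣ s i i∈s ⟩
      suc ∣ s ─ i ∣ ∎)
      where open ≤-Reasoning

    module _ (j₁ j₂ : Fin b) (j₁≢j₂ : j₁ ≢ j₂) (s₁ s₂ : FinSet a) where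

      image-∪⊆ : image E (((s₁ ─ i) ∪ (s₂ ─ i)) ∪ ⁅ i ⁆) ⊆ survivors s₁ j₁ ∪ survivors s₂ j₂
      image-∪⊆ y p with image-elim E _ y p
      ... | x , x∈C , Exy with ∨-elim ((s₁ ─ i) x ∨ (s₂ ─ i) x) x∈C
      ... | inj₁ q with ∨-elim ((s₁ ─ i) x) q
      ... | inj₁ x∈A = ∨-introˡ (∨-introˡ (image-intro E (s₁ ─ i) x y x∈A Exy))
      ... | inj₂ x∈B = ∨-introʳ (survivors s₁ j₁ y) (∨-introˡ (image-intro E (s₂ ─ i) x y x∈B Exy))
      image-∪⊆ y p | x , x∈C , Exy | inj₂ x∈i with x∈⁅y⁆⇒x≡y i x x∈i
      ... | refl = edge-at-i y Exy (y ≟ j₁)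
        where
        edge-at-i : ∀ y → E i y ≡ true → Dec (y ≡ j₁) → y ∈ survivors s₁ j₁ ∪ survivors s₂ j₂
        edge-at-i y Eiy (no y≢j₁) = ∨-introˡ (∨-introʳ (image E (s₁ ─ i) y) (─-intro (E i) j₁ y Eiy y≢j₁))
        edge-at-i y Eiy (yes refl) = ∨-introʳ (survivors s₁ j₁ y)
                                       (∨-introʳ (image E (s₂ ─ i) y) (─-intro (E i) j₂ y Eiy j₁≢j₂))

      image-∩⊆ : image E ((s₁ ─ i) ∩ (s₂ ─ i)) ⊆ survivors s₁ j₁ ∩ survivors s₂ j₂
      image-∩⊆ y p =
        let (x , x∈A∩B , Exy) = image-elim E _ y p
            (x∈A , x∈B) = ∧-elim ((s₁ ─ i) x) x∈A∩B
        in ∧-intro (∨-introˡ (image-intro E _ x y x∈A Exy)) (∨-introˡ (image-intro E _ x y x∈B Exy))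

      rado : Deficient L (delete E i j₁) s₁ → ¬ Deficient L (delete E i j₂) s₂
      rado d₁@(s₁⊆L , _) d₂@(s₂⊆L , _) = 1+n≰n (begin
        suc (∣ A ∣ + ∣ B ∣)               ≡⟨ cong suc (sym (inclusion-exclusion A B)) ⟩
        suc (∣ A ∪ B ∣ + ∣ A ∩ B ∣)       ≡⟨ cong (_+ ∣ A ∩ B ∣) (sym (∣∪⁅⁆∣ (A ∪ B) i i∉A∪B)) ⟩
        ∣ C ∣ + ∣ A ∩ B ∣                 ≤⟨ +-mono-≤ (hall C C⊆L) (hall (A ∩ B) A∩B⊆L) ⟩
        ∣ image E C ∣ + ∣ image E (A ∩ B) ∣
                                          ≤⟨ +-mono-≤ (∣∣-mono image-∪⊆) (∣∣-mono image-∩⊆) ⟩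
        ∣ X₁ ∪ X₂ ∣ + ∣ X₁ ∩ X₂ ∣         ≡⟨ inclusion-exclusion X₁ X₂ ⟩
        ∣ X₁ ∣ + ∣ X₂ ∣                   ≤⟨ +-mono-≤ (few-survivors s₁ j₁ d₁) (few-survivors s₂ j₂ d₂) ⟩
        ∣ A ∣ + ∣ B ∣ ∎)
        where
        open ≤-Reasoning
        A B C : FinSet a
        A = s₁ ─ i
        B = s₂ ─ i
        C = (A ∪ B) ∪ ⁅ i ⁆
        X₁ X₂ : FinSet b
        X₁ = survivors s₁ j₁
        X₂ = survivors s₂ j₂
        A⊆L : A ⊆ L
        A⊆L x p = s₁⊆L x (proj₁ (─-elim s₁ i x p))
        B⊆L : B ⊆ L
        B⊆L x p = s₂⊆L x (proj₁ (─-elim s₂ i x p))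
        C⊆L : C ⊆ L
        C⊆L x p with ∨-elim ((A ∪ B) x) p
        ... | inj₂ x∈i = ⁅⁆⊆ L i i∈L x x∈i
        ... | inj₁ q with ∨-elim (A x) q
        ... | inj₁ x∈A = A⊆L x x∈A
        ... | inj₂ x∈B = B⊆L x x∈B
        A∩B⊆L : A ∩ B ⊆ L
        A∩B⊆L x p = A⊆L x (proj₁ (∧-elim (A x) p))
        i∉A∪B : i ∉ A ∪ B
        i∉A∪B p with ∨-elim (A i) p
        ... | inj₁ i∈A = proj₂ (─-elim s₁ i i i∈A) refl
        ... | inj₂ i∈B = proj₂ (─-elim s₂ i i i∈B) refl

  module SingleEdges {a b} (L : FinSet a) (E : FinRel a b) (hall : HallCondition L E)
                     (≤1 : ∀ i → i ∈ L → ∣ E i ∣ ≤ 1) where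

    has-edge : ∀ i → i ∈ L → Σ (Fin b) λ j → E i j ≡ true
    has-edge i i∈L = nonempty (E i) (begin
      1                      ≡⟨ sym (∣⁅⁆∣≡1 i) ⟩
      ∣ ⁅ i ⁆ ∣              ≤⟨ hall ⁅ i ⁆ (⁅⁆⊆ L i i∈L) ⟩
      ∣ image E ⁅ i ⁆ ∣      ≤⟨ ∣∣-mono image⊆row ⟩
      ∣ E i ∣ ∎)
      where
      open ≤-Reasoning
      image⊆row : image E ⁅ i ⁆ ⊆ E i
      image⊆row y p = let (x , x∈i , Exy) = image-elim E ⁅ i ⁆ y p
                      in subst (λ z → E z y ≡ true) (x∈⁅y⁆⇒x≡y i x x∈i) Exy

    partner : ∀ i → i ∈ L → Fin b
    partner i p = proj₁ (has-edge i p)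

    -- Two vertices sharing their unique neighbour would violate Hall's
    -- condition on the pair.
    injective : ∀ i i' p p' → partner i p ≡ partner i' p' → i ≡ i'
    injective i i' p p' same with i ≟ i'
    ... | yes i≡i' = i≡i'
    ... | no  i≢i' = ⊥-elim (1+n≰n (begin
      2                         ≡⟨ cong suc (sym (∣⁅⁆∣≡1 i)) ⟩
      suc ∣ ⁅ i ⁆ ∣             ≡⟨ sym (∣∪⁅⁆∣ ⁅ i ⁆ i' (λ q → i≢i' (sym (x∈⁅y⁆⇒x≡y i i' q)))) ⟩
      ∣ pair ∣                  ≤⟨ hall pair pair⊆L ⟩
      ∣ image E pair ∣          ≤⟨ ∣∣-mono image⊆⁅j⁆ ⟩
      ∣ ⁅ j ⁆ ∣                 ≡⟨ ∣⁅⁆∣≡1 j ⟩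
      1 ∎))
      where
      open ≤-Reasoning
      j : Fin b
      j = partner i p
      pair : FinSet a
      pair = ⁅ i ⁆ ∪ ⁅ i' ⁆
      pair⊆L : pair ⊆ L
      pair⊆L x q with ∨-elim (⁅ i ⁆ x) q
      ... | inj₁ x∈i  = ⁅⁆⊆ L i p x x∈i
      ... | inj₂ x∈i' = ⁅⁆⊆ L i' p' x x∈i'
      only-neighbour : ∀ k (k∈L : k ∈ L) y → E k y ≡ true → y ≡ partner k k∈L
      only-neighbour k k∈L y Eky = ∣∣≤1⇒unique (E k) _ y (≤1 k k∈L) (proj₂ (has-edge k k∈L)) Eky
      image⊆⁅j⁆ : image E pair ⊆ ⁅ j ⁆
      image⊆⁅j⁆ y q with image-elim E pair y q
      ... | x , x∈pair , Exy with ∨-elim (⁅ i ⁆ x) x∈pair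
      ... | inj₁ x∈i  rewrite x∈⁅y⁆⇒x≡y i x x∈i =
            subst (_∈ ⁅ j ⁆) (sym (only-neighbour i p y Exy)) (x∈⁅x⁆ j)
      ... | inj₂ x∈i' rewrite x∈⁅y⁆⇒x≡y i' x x∈i' =
            subst (_∈ ⁅ j ⁆) (sym (trans (only-neighbour i' p' y Exy) (sym same))) (x∈⁅x⁆ j)

    matching : Matching L E
    matching = record { partner = partner ; adjacent = λ i p → proj₂ (has-edge i p) ; injective = injective }

  hall-theorem : ∀ {a b} (L : FinSet a) (E : FinRel a b) → HallCondition L E → Matching L E
  hall-theorem {a} {b} L E = go E (<-wellFounded (edges E))
    where
    go : ∀ E → Acc _<_ (edges E) → HallCondition L E → Matching L E
    go E (acc smaller) hall with any? (λ i → (L i ≟ᵇ true) ×-dec (2 ≤? ∣ E i ∣))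
    ... | no none = SingleEdges.matching L E hall
                      (λ i i∈L → ≮⇒≥ λ two → none (i , i∈L , two))
    ... | yes (i , i∈L , two) = try (hall? L (delete E i j₁)) (hall? L (delete E i j₂))
      where
      first : Σ (Fin b) (_∈ E i)
      first = nonempty (E i) (≤-trans (s≤s z≤n) two)
      j₁ : Fin b
      j₁ = proj₁ first
      second : Σ (Fin b) (_∈ E i ─ j₁)
      second = nonempty (E i ─ j₁) (≤-pred (subst (2 ≤_) (∣─∣ (E i) j₁ (proj₂ first)) two))
      j₂ : Fin b
      j₂ = proj₁ second
      Eij₂ : j₂ ∈ E i × j₂ ≢ j₁
      Eij₂ = ─-elim (E i) j₁ j₂ (proj₂ second)
      recurse : ∀ j → E i j ≡ true → HallCondition L (delete E i j) → Matching L E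
      recurse j Eij hall' =
        matching-⊆ (delete-⊆ E i j) (go (delete E i j) (smaller (edges-delete E i j Eij)) hall')
      Outcome : Fin b → Set
      Outcome j = HallCondition L (delete E i j) ⊎ Σ (FinSet a) (Deficient L (delete E i j))
      try : Outcome j₁ → Outcome j₂ → Matching L E
      try (inj₁ hall₁) _            = recurse j₁ (proj₂ first) hall₁
      try (inj₂ _)     (inj₁ hall₂) = recurse j₂ (proj₁ Eij₂) hall₂
      try (inj₂ (s₁ , d₁)) (inj₂ (s₂ , d₂)) =
        ⊥-elim (Rado.rado L E hall i i∈L j₁ j₂ (λ e → proj₂ Eij₂ (sym e)) s₁ s₂ d₁ d₂)

  -- Reading a matching backwards: each right vertex j is sent to its matched
  -- left vertex, or to a fixed default vertex if it is unmatched.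
  module Inverse {a b} {L : FinSet a} {E : FinRel a b} (M : Matching L E) (default : Fin a) where
    open Matching M

    MatchedTo : Fin b → Set
    MatchedTo j = Σ (Fin a) λ i → Σ (i ∈ L) λ p → partner i p ≡ j

    matched? : ∀ j → Dec (MatchedTo j)
    matched? j = any? λ i → matched-at i (L i) refl
      where
      matched-at : ∀ i b → L i ≡ b → Dec (Σ (i ∈ L) λ p → partner i p ≡ j)
      matched-at i false i∉L = no λ (p , _) → true≢false (trans (sym p) i∉L)
      matched-at i true  i∈L with partner i i∈L ≟ j
      ... | yes q = yes (i∈L , q)
      ... | no  q = no λ (p , r) → q (subst (λ p → partner i p ≡ j) (≡true-irrelevant p i∈L) r)

    inverse : Fin b → Fin a
    inverse j with matched? j
    ... | yes (i , _) = i
    ... | no  _       = default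

    inverse-spec : ∀ j → (Σ (MatchedTo j) λ (i , _) → inverse j ≡ i) ⊎ (inverse j ≡ default × ¬ MatchedTo j)
    inverse-spec j with matched? j
    ... | yes μ    = inj₁ (μ , refl)
    ... | no  none = inj₂ (refl , none)

    partner-cong : ∀ {i i'} p p' → i ≡ i' → partner i p ≡ partner i' p'
    partner-cong p p' refl = cong (partner _) (≡true-irrelevant p p')

    inverse-edge : ∀ j → inverse j ≡ default ⊎ (inverse j ∈ L × E (inverse j) j ≡ true)
    inverse-edge j with inverse-spec j
    ... | inj₂ (at-default , _)    = inj₁ at-default
    ... | inj₁ ((i , p , q) , at-i) =
          inj₂ (subst (_∈ L) (sym at-i) p , subst₂ (λ x y → E x y ≡ true) (sym at-i) q (adjacent i p))

    inverse-injective : ∀ j j' → inverse j ≡ inverse j' → inverse j ≢ default → j ≡ j'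
    inverse-injective j j' same off with inverse-spec j | inverse-spec j'
    ... | inj₂ (at-default , _) | _ = ⊥-elim (off at-default)
    ... | inj₁ _ | inj₂ (at-default , _) = ⊥-elim (off (trans same at-default))
    ... | inj₁ ((i , p , q) , at-i) | inj₁ ((i' , p' , q') , at-i') =
          trans (sym q) (trans (partner-cong p p' (trans (sym at-i) (trans same at-i'))) q')

    inverse-onto : ∀ i → i ∈ L → Σ (Fin b) λ j → inverse j ≡ i
    inverse-onto i p with inverse-spec (partner i p)
    ... | inj₁ ((i' , p' , q) , at-i') = partner i p , trans at-i' (injective i' i p' p q)
    ... | inj₂ (_ , none)              = ⊥-elim (none (i , p , refl))

module Occupancy where

  open import Level using (0ℓ)
  open import Data.Nat using (ℕ; zero; suc)
  open import Data.Fin using (Fin; zero; suc; _≟_)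
  open import Data.Bool using (true; false)
  open import Data.List using (length; filter; tabulate)
  open import Relation.Nullary using (does)
  open import Relation.Unary using (Pred; Decidable)
  open import Relation.Binary.PropositionalEquality using (_≡_; refl; cong)
  open FiniteSets

  occupants : (G : Graph) {k : ℕ} → Conf G k → Fin (n G) → FinSet k
  occupants G X w i = ⁅ w ⁆ (X i)

  length-filter-tabulate : ∀ {A : Set} {k} (g : Fin k → A) {P : Pred A 0ℓ} (P? : Decidable P) →
    length (filter P? (tabulate g)) ≡ ∣ (λ i → does (P? (g i))) ∣
  length-filter-tabulate {k = zero}  g P? = refl
  length-filter-tabulate {k = suc k} g P? with does (P? (g zero))
  ... | true  = cong suc (length-filter-tabulate (λ i → g (suc i)) P?)
  ... | false = length-filter-tabulate (λ i → g (suc i)) P?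

  countAt≡∣occupants∣ : (G : Graph) {k : ℕ} (X : Conf G k) (w : Fin (n G)) →
    countAt G X w ≡ ∣ occupants G X w ∣
  countAt≡∣occupants∣ G X w = length-filter-tabulate (λ i → i) (λ i → X i ≟ w)

-- The spies keep
-- the invariant that every heavy vertex (one with at least m revolutionaries)
-- is guarded, and every spy not on v guards a heavy vertex of its own.  After
-- the revolutionaries move, Hall's theorem matches the new heavy vertices to
-- spies that can reach them; the unmatched spies retreat to v.
module SpyStrategy (G : Graph) (v : Fin (n G)) (dom : ∀ u → u ≢ v → Adj G v u)
                   (m r : ℕ) .{{_ : NonZero m}} where

  open import Data.Nat using (_≤?_; z≤n)
  open import Data.Nat.Properties
    using (≤-trans; ≤-pred; ≰⇒>; <⇒≱; +-mono-≤; +-cancelʳ-≤; *-distribˡ-+; *-comm;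
           module ≤-Reasoning)
  open import Data.Nat.DivMod using (m*n/n≡m; /-monoˡ-≤)
  open import Data.Bool using (true; _∨_; _∧_)
  open import Data.Fin using (_≟_)
  open import Data.List using ([]; _∷_)
  open import Data.Product using (Σ; _,_)
  open import Data.Sum using (_⊎_; inj₁; inj₂)
  open import Data.Empty using (⊥-elim)
  open import Relation.Nullary using (¬_; yes; no; does)
  open import Relation.Nullary.Decidable using (dec-true)
  open import Relation.Binary.PropositionalEquality
  open FiniteSets
  open HallsTheorem
  open Occupancy

  k : ℕ
  k = r / m

  V : Set
  V = Fin (n G)

  heavy : Conf G r → FinSet (n G)
  heavy R w = does (m ≤? countAt G R w)

  heavy-sound : ∀ R w → w ∈ heavy R → m ≤ countAt G R w
  heavy-sound R w = does⇒ (m ≤? countAt G R w)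

  heavy-complete : ∀ R w → m ≤ countAt G R w → w ∈ heavy R
  heavy-complete R w = dec-true (m ≤? countAt G R w)

  record Thrifty (R : Conf G r) (P : Conf G k) : Set where
    field
      off-v-heavy : ∀ j → P j ≢ v → m ≤ countAt G R (P j)
      off-v-alone : ∀ j j' → P j ≡ P j' → P j ≢ v → j ≡ j'

  record Guarding (R : Conf G r) (P : Conf G k) : Set where
    field
      thrifty : Thrifty R P
      covers  : ∀ w → m ≤ countAt G R w → Σ (Fin k) λ j → P j ≡ w

  -- Where spy j, standing on Pp j, may go when the revolutionaries move from
  -- Rp to R': anywhere from v, to v from anywhere, or along with a
  -- revolutionary who left its vertex.
  options : Conf G r → Conf G k → Conf G r → FinRel (n G) k
  options Rp Pp R' w j = (⁅ v ⁆ (Pp j) ∨ ⁅ v ⁆ w) ∨ any (λ i → ⁅ Pp j ⁆ (Rp i) ∧ ⁅ w ⁆ (R' i))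

  to-v : ∀ u → v ≡ u ⊎ Adj G u v
  to-v u with u ≟ v
  ... | yes u≡v = inj₁ (sym u≡v)
  ... | no  u≢v = inj₂ (Graph.sym G (dom u u≢v))

  from-v : ∀ u → u ≡ v ⊎ Adj G v u
  from-v u with u ≟ v
  ... | yes u≡v = inj₁ u≡v
  ... | no  u≢v = inj₂ (dom u u≢v)

  option-legal : ∀ {Rp R'} Pp → Step G Rp R' → ∀ j w →
    options Rp Pp R' w j ≡ true → w ≡ Pp j ⊎ Adj G (Pp j) w
  option-legal {Rp} {R'} Pp step j w p with ∨-elim (⁅ v ⁆ (Pp j) ∨ ⁅ v ⁆ w) p
  ... | inj₁ q with ∨-elim (⁅ v ⁆ (Pp j)) q
  ... | inj₁ at-v rewrite x∈⁅y⁆⇒x≡y v (Pp j) at-v = from-v w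
  ... | inj₂ to-v' rewrite x∈⁅y⁆⇒x≡y v w to-v' = to-v (Pp j)
  option-legal {Rp} {R'} Pp step j w p | inj₂ q with any-elim _ q
  ... | i , follows with ∧-elim (⁅ Pp j ⁆ (Rp i)) follows
  ... | from , to with x∈⁅y⁆⇒x≡y (Pp j) (Rp i) from | x∈⁅y⁆⇒x≡y w (R' i) to | step i
  ... | from-Pj | to-w | inj₁ stay  = inj₁ (trans (sym to-w) (trans stay from-Pj))
  ... | from-Pj | to-w | inj₂ moved = inj₂ (subst₂ (Adj G) from-Pj to-w moved)

  ≤-quotient : ∀ x → x * m ≤ r → x ≤ k
  ≤-quotient x le = subst (_≤ k) (m*n/n≡m x m) (/-monoˡ-≤ m le)

  -- The counting heart of the proof: if the spies were thrifty, the new heavy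
  -- vertices satisfy Hall's condition.  For a nonempty set s of them, the
  -- spies Q that cannot reach s sit off v on distinct heavy vertices whose
  -- revolutionaries all avoid s; so m|s| + m|Q| ≤ r, i.e. |s| + |Q| ≤ k.
  module _ {Rp : Conf G r} {Pp : Conf G k} (th : Thrifty Rp Pp) (R' : Conf G r) where
    open Thrifty th

    module Count (s : FinSet (n G)) (s⊆heavy : s ⊆ heavy R') (w₀ : V) (w₀∈s : w₀ ∈ s) where
      N Q : FinSet k
      N = image (options Rp Pp R') s
      Q = ∁ N

      Q-off-v : ∀ j → j ∈ Q → Pp j ≢ v
      Q-off-v j j∈Q at-v = not-true j∈Q
        (image-intro (options Rp Pp R') s w₀ j w₀∈s (∨-introˡ (∨-introˡ (subst (_∈ ⁅ v ⁆) (sym at-v) (x∈⁅x⁆ v)))))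

      arrived stayed : FinSet r
      arrived = image (occupants G R') s
      stayed  = image (λ j → occupants G Rp (Pp j)) Q

      separate : ∀ i → i ∈ arrived → i ∉ stayed
      separate i p q =
        let (w , w∈s , at-w) = image-elim (occupants G R') s i p
            (j , j∈Q , at-j) = image-elim (λ j → occupants G Rp (Pp j)) Q i q
        in not-true j∈Q (image-intro (options Rp Pp R') s w j w∈s
             (∨-introʳ (⁅ v ⁆ (Pp j) ∨ ⁅ v ⁆ w) (any-intro (λ i → ⁅ Pp j ⁆ (Rp i) ∧ ⁅ w ⁆ (R' i)) i (∧-intro at-j at-w))))

      many-arrived : m * ∣ s ∣ ≤ ∣ arrived ∣
      many-arrived = disjoint-blocks m s (occupants G R')
        (λ w w∈s → subst (m ≤_) (countAt≡∣occupants∣ G R' w) (heavy-sound R' w (s⊆heavy w w∈s)))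
        (λ w w' i _ _ p p' → trans (sym (x∈⁅y⁆⇒x≡y w (R' i) p)) (x∈⁅y⁆⇒x≡y w' (R' i) p'))

      many-stayed : m * ∣ Q ∣ ≤ ∣ stayed ∣
      many-stayed = disjoint-blocks m Q (λ j → occupants G Rp (Pp j))
        (λ j j∈Q → subst (m ≤_) (countAt≡∣occupants∣ G Rp (Pp j)) (off-v-heavy j (Q-off-v j j∈Q)))
        (λ j j' i j∈Q _ p p' → off-v-alone j j'
           (trans (sym (x∈⁅y⁆⇒x≡y (Pp j) (Rp i) p)) (x∈⁅y⁆⇒x≡y (Pp j') (Rp i) p')) (Q-off-v j j∈Q))

      s+Q≤k : ∣ s ∣ + ∣ Q ∣ ≤ k
      s+Q≤k = ≤-quotient (∣ s ∣ + ∣ Q ∣) (begin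
        (∣ s ∣ + ∣ Q ∣) * m              ≡⟨ *-comm (∣ s ∣ + ∣ Q ∣) m ⟩
        m * (∣ s ∣ + ∣ Q ∣)              ≡⟨ *-distribˡ-+ m ∣ s ∣ ∣ Q ∣ ⟩
        m * ∣ s ∣ + m * ∣ Q ∣            ≤⟨ +-mono-≤ many-arrived many-stayed ⟩
        ∣ arrived ∣ + ∣ stayed ∣         ≡⟨ sym (∣∪∣-disjoint arrived stayed separate) ⟩
        ∣ arrived ∪ stayed ∣             ≤⟨ ∣∣≤size (arrived ∪ stayed) ⟩
        r ∎)
        where open ≤-Reasoning

      enough-neighbours : ∣ s ∣ ≤ ∣ N ∣
      enough-neighbours = +-cancelʳ-≤ (∣ Q ∣) (∣ s ∣) (∣ N ∣) (subst (∣ s ∣ + ∣ Q ∣ ≤_) (sym (∣∣+∣∁∣ N)) s+Q≤k)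

    hall-condition : HallCondition (heavy R') (options Rp Pp R')
    hall-condition s s⊆heavy with 1 ≤? ∣ s ∣
    ... | no  empty = ≤-trans (≤-pred (≰⇒> empty)) z≤n
    ... | yes ne    = let (w₀ , w₀∈s) = nonempty s ne in Count.enough-neighbours s s⊆heavy w₀ w₀∈s

  -- The spies' answer to the move Rp ↦ R': read a Hall matching of the new
  -- heavy vertices backwards, unmatched spies going to v.  If Hall's
  -- condition failed (the invariant rules this out) all spies go to v.
  module _ (Rp : Conf G r) (Pp : Conf G k) (R' : Conf G r) where

    answer : HallCondition (heavy R') (options Rp Pp R') ⊎ Σ (FinSet (n G)) (Deficient (heavy R') (options Rp Pp R')) →
             Conf G k
    answer (inj₁ hall) = Inverse.inverse (hall-theorem (heavy R') (options Rp Pp R') hall) v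
    answer (inj₂ _)    = λ _ → v

    response : Conf G k
    response = answer (hall? (heavy R') (options Rp Pp R'))

    answer-legal : Step G Rp R' → ∀ d → Step G Pp (answer d)
    answer-legal step (inj₂ _)    j = to-v (Pp j)
    answer-legal step (inj₁ hall) j with Inverse.inverse-edge (hall-theorem (heavy R') (options Rp Pp R') hall) v j
    ... | inj₁ at-v       = subst (λ w → w ≡ Pp j ⊎ Adj G (Pp j) w) (sym at-v) (to-v (Pp j))
    ... | inj₂ (_ , edge) = option-legal Pp step j _ edge

    answer-guarding : Thrifty Rp Pp → ∀ d → Guarding R' (answer d)
    answer-guarding th (inj₂ (s , s⊆heavy , small)) = ⊥-elim (<⇒≱ small (hall-condition th R' s s⊆heavy))
    answer-guarding th (inj₁ hall) = record
      { thrifty = record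
        { off-v-heavy = off-v-heavy
        ; off-v-alone = inverse-injective }
      ; covers  = λ w heavy-w → inverse-onto w (heavy-complete R' w heavy-w) }
      where
      open Inverse (hall-theorem (heavy R') (options Rp Pp R') hall) v
      off-v-heavy : ∀ j → inverse j ≢ v → m ≤ countAt G R' (inverse j)
      off-v-heavy j off with inverse-edge j
      ... | inj₁ at-v          = ⊥-elim (off at-v)
      ... | inj₂ (is-heavy , _) = heavy-sound R' (inverse j) is-heavy

    response-legal : Step G Rp R' → Step G Pp response
    response-legal step = answer-legal step (hall? (heavy R') (options Rp Pp R'))

    response-guarding : Thrifty Rp Pp → Guarding R' response
    response-guarding th = answer-guarding th (hall? (heavy R') (options Rp Pp R'))

  -- The strategy: answer the latest move (the initial placement counts as a
  -- move from everybody standing where they are, with all spies on v).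
  strategy : SpyStrategy G r k
  strategy []              R' = response R' (λ _ → v) R'
  strategy ((R , P) ∷ _)   R' = response R P R'

  all-on-v : ∀ R → Thrifty R (λ _ → v)
  all-on-v R = record { off-v-heavy = λ j off → ⊥-elim (off refl) ; off-v-alone = λ j j' _ off → ⊥-elim (off refl) }

  guarded : ∀ {h R P} → Consistent G strategy ((R , P) ∷ h) → Guarding R P
  guarded (start R)        = response-guarding R (λ _ → v) R (all-on-v R)
  guarded (next c R' step) = response-guarding _ _ R' (Guarding.thrifty (guarded c))

  spies-win : SpiesWin G m r k
  spies-win = strategy , legal , no-revolution
    where
    legal : ∀ {h R P} → Consistent G strategy ((R , P) ∷ h) →
            ∀ R' → Step G R R' → Step G P (strategy ((R , P) ∷ h) R')
    legal {R = R} {P} _ R' step = response-legal R P R' step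
    no-revolution : ∀ {h R P} → Consistent G strategy ((R , P) ∷ h) → ¬ RevWin G m R P
    no-revolution c (w , heavy-w , unguarded) =
      let (j , at-w) = Guarding.covers (guarded c) w heavy-w in unguarded j at-w

module Covering where

  open import Data.Nat using (_<_)
  open import Data.Nat.Properties using (<-irrefl)
  open import Data.Fin using (Fin; toℕ; _≟_)
  open import Data.Fin.Properties using (any?; all?; pigeonhole)
  open import Data.Product using (Σ; _,_; proj₁; proj₂)
  open import Data.Empty using (⊥-elim)
  open import Relation.Nullary using (yes; no; ¬?)
  open import Relation.Binary.PropositionalEquality

  uncovered : ∀ {a s K} → s < K → (e : Fin K → Fin a) → (∀ c c' → e c ≡ e c' → c ≡ c') →
    (P : Fin s → Fin a) → Σ (Fin K) λ c → ∀ j → P j ≢ e c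
  uncovered {s = s} {K} s<K e e-injective P with any? (λ c → all? (λ j → ¬? (P j ≟ e c)))
  ... | yes found = found
  ... | no  none  =
    -- Every e c is hit by some point; two distinct c share their point.
    let (c , c' , c<c' , same-point) = pigeonhole s<K (λ c → proj₁ (cover c))
        c≡c' = e-injective c c' (trans (sym (proj₂ (cover c)))
                 (trans (cong P same-point) (proj₂ (cover c'))))
    in ⊥-elim (<-irrefl (cong toℕ c≡c') c<c')
    where
    cover : ∀ c → Σ (Fin s) λ j → P j ≡ e c
    cover c with any? (λ j → P j ≟ e c)
    ... | yes hit = hit
    ... | no  miss = ⊥-elim (none (c , λ j hit → miss (j , hit)))

-- The
-- revolutionaries put m of them on each of K distinct vertices (the surplus
-- joins one of them); some of these vertices is left unguarded already after
-- the initial placement.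
module RevolutionaryStrategy (G : Graph) (m r K : ℕ) .{{_ : NonZero m}}
                             (K*m≤r : K * m ≤ r) (K≤|V| : K ≤ n G) (c₀ : Fin K) where

  open import Data.Nat using (suc; _<_; _<?_)
  open import Data.Nat.Properties
    using (+-identityʳ; +-comm; +-monoʳ-<; *-monoˡ-≤; +-cancelˡ-≡; module ≤-Reasoning)
  open import Data.Nat.DivMod using (+-distrib-/-∣ˡ; m*n/n≡m; m<n⇒m/n≡0)
  open import Data.Nat.Divisibility using (n∣m*n)
  open import Data.Fin using (toℕ; fromℕ<; inject≤)
  open import Data.Fin.Properties using (toℕ<n; toℕ-fromℕ<; fromℕ<-toℕ; toℕ-injective; inject≤-injective)
  open import Data.List using ([])
  open import Data.Empty using (⊥-elim)
  open import Relation.Nullary using (¬_; yes; no)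
  open import Relation.Binary.PropositionalEquality
  open FiniteSets
  open Occupancy
  open Covering

  target : Fin K → Fin (n G)
  target c = inject≤ c K≤|V|

  -- Block numbers beyond K are sent to the block c₀.
  block-of : ℕ → Fin K
  block-of c with c <? K
  ... | yes c<K = fromℕ< c<K
  ... | no  _   = c₀

  block-of-toℕ : ∀ c → block-of (toℕ c) ≡ c
  block-of-toℕ c with toℕ c <? K
  ... | yes c<K = fromℕ<-toℕ c c<K
  ... | no  c≮K = ⊥-elim (c≮K (toℕ<n c))

  placement : Conf G r
  placement i = target (block-of (toℕ i / m))

  [cm+d]/m≡c : ∀ c d → d < m → (c * m + d) / m ≡ c
  [cm+d]/m≡c c d d<m = begin
    (c * m + d) / m       ≡⟨ +-distrib-/-∣ˡ d (n∣m*n c) ⟩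
    c * m / m + d / m     ≡⟨ cong₂ _+_ (m*n/n≡m c m) (m<n⇒m/n≡0 d<m) ⟩
    c + 0                 ≡⟨ +-identityʳ c ⟩
    c ∎
    where open ≡-Reasoning

  member : Fin K → Fin m → Fin r
  member c d = fromℕ< (begin-strict
    toℕ c * m + toℕ d     <⟨ +-monoʳ-< (toℕ c * m) (toℕ<n d) ⟩
    toℕ c * m + m         ≡⟨ +-comm (toℕ c * m) m ⟩
    suc (toℕ c) * m       ≤⟨ *-monoˡ-≤ m (toℕ<n c) ⟩
    K * m                 ≤⟨ K*m≤r ⟩
    r ∎)
    where open ≤-Reasoning

  member-injective : ∀ c d d' → member c d ≡ member c d' → d ≡ d'
  member-injective c d d' same = toℕ-injective (+-cancelˡ-≡ (toℕ c * m) _ _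
    (trans (sym (toℕ-fromℕ< _)) (trans (cong toℕ same) (toℕ-fromℕ< _))))

  member-placed : ∀ c d → placement (member c d) ≡ target c
  member-placed c d = cong target (begin
    block-of (toℕ (member c d) / m)     ≡⟨ cong (λ x → block-of (x / m)) (toℕ-fromℕ< _) ⟩
    block-of ((toℕ c * m + toℕ d) / m)  ≡⟨ cong block-of ([cm+d]/m≡c (toℕ c) (toℕ d) (toℕ<n d)) ⟩
    block-of (toℕ c)                    ≡⟨ block-of-toℕ c ⟩
    c ∎)
    where open ≡-Reasoning

  crowded : ∀ c → m ≤ countAt G placement (target c)
  crowded c = subst (m ≤_) (sym (countAt≡∣occupants∣ G placement (target c)))
    (injection⇒≤∣∣ (occupants G placement (target c)) (member c) (member-injective c)
      (λ d → subst (_∈ ⁅ target c ⁆) (sym (member-placed c d)) (x∈⁅x⁆ (target c))))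

  spies-lose : ∀ s → s < K → ¬ SpiesWin G m r s
  spies-lose s s<K (σ , _ , never) =
    let (c , free) = uncovered s<K target (inject≤-injective K≤|V| K≤|V|) (σ [] placement)
    in never (start placement) (target c , crowded c , free)

-- The theorem: ⌊r/m⌋ spies win (SpyStrategy), fewer lose (RevolutionaryStrategy,
-- applicable since ⌊r/m⌋ · m ≤ r and ⌊r/m⌋ ≤ r - m + 1 ≤ |V(G)|).
theorem2p2 : (G : Graph) → HasDominatingVertex G →
    (m r : ℕ) → .{{_ : NonZero m}} → 1 ≤ r →
    r ∸ m + 1 ≤ ∣V∣ G → r / m ≤ r ∸ m + 1 → 1 ≤ r / m →
    IsSigma G m r (r / m)
theorem2p2 G (v , dominating) m r _ |V|-large quotient-small quotient-positive =
    SpyStrategy.spies-win G v dominating m r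
  , RevolutionaryStrategy.spies-lose G m r (r / m) (m/n*n≤m r m)
      (≤-trans quotient-small |V|-large) (fromℕ< quotient-positive)
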